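{- If $G=P_n$ is the path on $n\ge 2$ vertices, then $\mathrm{fpt}(G)=n-1$.
   Context: Zero forcing: given a set $B\subseteq V(G)$ of initially blue vertices (all others white), the color change rule allows a blue vertex $b$ to turn a white vertex $w$ blue if $w$ is the unique white neighbor of $b$. $B$ is a zero forcing set if repeated application eventually turns all of $V(G)$ blue. Propagation: set $B^{[0]}=B$ and for $i\ge1$ let $B^{(i)}$ be the set of vertices $u\notin B^{[i-1]}$ such that some $v\in B^{[i-1]}$ has $u$ as its unique neighbor outside $B^{[i-1]}$, and $B^{[i]}=B^{[i-1]}\cup B^{(i)}$; $\mathrm{pt}(G,B)$ is the least $k$ with $B^{[k]}=V(G)$. A set $B$ with $|B|=m\ge1$ is a fault tolerant zero forcing set if every $(m-1)$-subset of $B$ is a zero forcing set; $\mathrm{Z}_t(G)$ is the minimum size of such a set, and a fault tolerant zero forcing set of that size is called minimum. For a fault tolerant zero forcing set $B$, $\mathrm{fpt}(G,B)=\max_{b\in B}\mathrm{pt}(G,B\setminus\{b\})$, and $\mathrm{fpt}(G)=\min\{\mathrm{fpt}(G,B): B \text{ a minimum fault tolerant zero forcing set of } G\}$. -}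

module Defs where

open import Data.Nat using (ℕ; zero; suc; _≤_; _<_; _∸_)
open import Data.Nat.Properties using () renaming (_≟_ to _≟ℕ_)
open import Data.Fin using (Fin; toℕ)
open import Data.Fin.Properties using (any?; all?; _≟_)
open import Data.Fin.Subset using (Subset; _∈_; _∉_; _⊆_; _∪_; _─_; ⁅_⁆; ∣_∣; ⊤)
open import Data.Fin.Subset.Properties using (_∈?_)
open import Data.Vec using (tabulate)
open import Data.Product using (Σ; ∃; _×_; _,_)
open import Data.Sum using (_⊎_)
open import Data.Empty using (⊥)
open import Relation.Nullary using (Dec; ¬_; yes; no; does)
open import Relation.Nullary.Decidable using (_×-dec_; _⊎-dec_; ¬?; _→-dec_)
open import Relation.Binary.PropositionalEquality using (_≡_; _≢_)

record Graph (n : ℕ) : Set₁ where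
  field
    Adj    : Fin n → Fin n → Set
    adj?   : ∀ u v → Dec (Adj u v)
    sym    : ∀ {u v} → Adj u v → Adj v u
    irrefl : ∀ {u} → ¬ Adj u u
open Graph public

PathAdj : ∀ {n} → Fin n → Fin n → Set
PathAdj i j = (suc (toℕ i) ≡ toℕ j) ⊎ (suc (toℕ j) ≡ toℕ i)

private
  suc≢ : ∀ m → suc m ≢ m
  suc≢ zero ()
  suc≢ (suc m) e = suc≢ m (Data.Nat.Properties.suc-injective e)
    where import Data.Nat.Properties

PathGraph : (n : ℕ) → Graph n
PathGraph n = record
  { Adj    = PathAdj
  ; adj?   = λ i j → (suc (toℕ i) ≟ℕ toℕ j) ⊎-dec (suc (toℕ j) ≟ℕ toℕ i)
  ; sym    = λ { (_⊎_.inj₁ e) → _⊎_.inj₂ e ; (_⊎_.inj₂ e) → _⊎_.inj₁ e }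
  ; irrefl = λ { {u} (_⊎_.inj₁ e) → suc≢ (toℕ u) e ; {u} (_⊎_.inj₂ e) → suc≢ (toℕ u) e }
  }

module _ {n : ℕ} (G : Graph n) where

  UniqueWhiteNbr : Subset n → Fin n → Fin n → Set
  UniqueWhiteNbr S v u = u ∉ S × Adj G v u × (∀ w → Adj G v w → w ∉ S → w ≡ u)

  uniqueWhiteNbr? : ∀ S v u → Dec (UniqueWhiteNbr S v u)
  uniqueWhiteNbr? S v u =
    ¬? (u ∈? S) ×-dec (adj? G v u ×-dec
      all? (λ w → adj? G v w →-dec (¬? (w ∈? S) →-dec (w ≟ u))))

  Forced : Subset n → Fin n → Set
  Forced S u = ∃ λ v → v ∈ S × UniqueWhiteNbr S v u

  forced? : ∀ S u → Dec (Forced S u)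
  forced? S u = any? (λ v → (v ∈? S) ×-dec uniqueWhiteNbr? S v u)

  newBlue : Subset n → Subset n
  newBlue S = tabulate (λ u → does (forced? S u))

  propagate : Subset n → ℕ → Subset n
  propagate B zero    = B
  propagate B (suc k) = propagate B k ∪ newBlue (propagate B k)

  IsZFS : Subset n → Set
  IsZFS B = ∃ λ k → propagate B k ≡ ⊤

  IsPT : Subset n → ℕ → Set
  IsPT B k = propagate B k ≡ ⊤ × (∀ j → j < k → propagate B j ≢ ⊤)

  IsFTZFS : Subset n → Set
  IsFTZFS B = 1 ≤ ∣ B ∣ × (∀ S → S ⊆ B → ∣ S ∣ ≡ ∣ B ∣ ∸ 1 → IsZFS S)

  IsMinFTZFS : Subset n → Set
  IsMinFTZFS B = IsFTZFS B × (∀ C → IsFTZFS C → ∣ B ∣ ≤ ∣ C ∣)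

  IsFPTOf : Subset n → ℕ → Set
  IsFPTOf B k =
    (∀ b → b ∈ B → ∃ λ j → IsPT (B ─ ⁅ b ⁆) j × j ≤ k) ×
    (∃ λ b → b ∈ B × IsPT (B ─ ⁅ b ⁆) k)

  IsFPT : ℕ → Set
  IsFPT k =
    (∃ λ B → IsMinFTZFS B × IsFPTOf B k) ×
    (∀ B j → IsMinFTZFS B → IsFPTOf B j → k ≤ j)

{-# OPTIONS --safe #-}
module Submission where

-- A fault tolerant zero forcing set needs two vertices, since the empty set forces nothing, and the
-- two endpoints of the path are one; so deleting a vertex from a minimum one leaves a single blue
-- vertex a. An interior a has two white neighbours and never forces anything, so a must be an
-- endpoint. Vertices blue at time k lie within distance k of the initial set, and from the endpoint
-- 0 every such vertex is indeed blue at time k, so the path is coloured after exactly n − 1 steps.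
-- The other endpoint is reduced to 0 by the reflection i ↦ n − 1 − i, an automorphism of the path.

open import Defs hiding (sym)
open import Data.Nat using (ℕ; zero; suc; _+_; _≤_; _<_; _∸_; z≤n; s≤s; ∣_-_∣)
open import Data.Nat.Properties
  using (module ≤-Reasoning; ≤-refl; ≤-reflexive; ≤-trans; ≤-pred; _≤?_; ≰⇒>; <⇒≱; <⇒≢; ≤∧≢⇒<;
         n<1+n; n≤1+n; n≮n; m≤n⇒m≤1+n; m≤n⇒m<n∨m≡n; m≤n⇒m∸n≡0; m<n⇒m<1+n; +-mono-≤; +-∸-assoc;
         ∣-∣-identityʳ; ∣-∣-comm; ∣-∣-triangle; ∣n-n∣≡0)
  renaming (_≟_ to _≟ℕ_)
open import Data.Fin using (Fin; toℕ; fromℕ; fromℕ<; inject₁; opposite) renaming (zero to fzero; suc to fsuc)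
open import Data.Fin.Properties
  using (_≟_; toℕ-injective; toℕ<n; toℕ-fromℕ; toℕ-fromℕ<; toℕ-inject₁; opposite-prop; opposite-involutive)
open import Data.Fin.Subset using (Subset; _∈_; _∉_; _⊆_; _∪_; _─_; ⁅_⁆; ∣_∣; ⊤; ⊥; inside; Nonempty)
open import Data.Fin.Subset.Properties
  using (x∈p∪q⁻; x∈p∪q⁺; ∈⊤; ⊆⊤; ∉⊥; ∣⊥∣≡0; x∈⁅x⁆; x∈⁅y⁆⇒x≡y; ∣⁅x⁆∣≡1; ⊆-antisym; ⊆-min;
         Empty-unique; nonempty?; p⊆q⇒∣p∣≤∣q∣; x∈p∧x≢y⇒x∈p-y; x∈p⇒∣p-x∣<∣p∣; p─q⊆p)
open import Data.Vec using (lookup; _∷_; here; there)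
open import Data.Vec.Properties using ([]=⇒lookup; lookup⇒[]=; lookup∘tabulate)
open import Data.Product using (∃; ∃₂; _×_; _,_; proj₁; swap)
open import Data.Sum using (_⊎_; inj₁; inj₂)
import Data.Sum as Sum
open import Data.Empty using (⊥-elim)
open import Function using (_∘_)
open import Relation.Nullary using (¬_; Dec; yes; no; does)
open import Relation.Nullary.Decidable using (dec-true)
open import Relation.Binary.PropositionalEquality
  using (_≡_; _≢_; refl; sym; trans; cong; cong₂; subst; module ≡-Reasoning)

≡⊤⇒∈ : ∀ {n} {p : Subset n} → p ≡ ⊤ → ∀ x → x ∈ p
≡⊤⇒∈ refl _ = ∈⊤

∀∈⇒≡⊤ : ∀ {n} {p : Subset n} → (∀ x → x ∈ p) → p ≡ ⊤
∀∈⇒≡⊤ all∈ = ⊆-antisym ⊆⊤ (λ {x} _ → all∈ x)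

x∈p⇒⁅x⁆⊆p : ∀ {n} {p : Subset n} {x} → x ∈ p → ⁅ x ⁆ ⊆ p
x∈p⇒⁅x⁆⊆p {p = p} {x} x∈p y∈⁅x⁆ = subst (_∈ p) (sym (x∈⁅y⁆⇒x≡y x y∈⁅x⁆)) x∈p

x∈p⇒1≤∣p∣ : ∀ {n} {p : Subset n} {x} → x ∈ p → 1 ≤ ∣ p ∣
x∈p⇒1≤∣p∣ {p = p} {x} x∈p = subst (_≤ ∣ p ∣) (∣⁅x⁆∣≡1 x) (p⊆q⇒∣p∣≤∣q∣ (x∈p⇒⁅x⁆⊆p x∈p))

1≤∣p∣⇒Nonempty : ∀ {n} (p : Subset n) → 1 ≤ ∣ p ∣ → Nonempty p
1≤∣p∣⇒Nonempty {n} p 1≤∣p∣ with nonempty? p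
... | yes ne = ne
... | no empty = ⊥-elim (<⇒≱ 1≤∣p∣ (≤-reflexive (trans (cong ∣_∣ (Empty-unique empty)) (∣⊥∣≡0 n))))

∣p∣≤1⇒⊆⁅x⁆ : ∀ {n} {p : Subset n} {x} → ∣ p ∣ ≤ 1 → x ∈ p → p ⊆ ⁅ x ⁆
∣p∣≤1⇒⊆⁅x⁆ {x = x} ∣p∣≤1 x∈p {y} y∈p with y ≟ x
... | yes refl = x∈⁅x⁆ x
... | no y≢x = ⊥-elim (<⇒≱ (x∈p⇒∣p-x∣<∣p∣ x∈p) (≤-trans ∣p∣≤1 (x∈p⇒1≤∣p∣ (x∈p∧x≢y⇒x∈p-y y∈p y≢x))))

∣p∣≤1⇒≡⁅x⁆ : ∀ {n} {p : Subset n} {x} → ∣ p ∣ ≤ 1 → x ∈ p → p ≡ ⁅ x ⁆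
∣p∣≤1⇒≡⁅x⁆ ∣p∣≤1 x∈p = ⊆-antisym (∣p∣≤1⇒⊆⁅x⁆ ∣p∣≤1 x∈p) (x∈p⇒⁅x⁆⊆p x∈p)

module _ {n} (G : Graph n) where

  lookup-newBlue : ∀ S u → lookup (newBlue G S) u ≡ does (forced? G S u)
  lookup-newBlue S = lookup∘tabulate (does ∘ forced? G S)

  ∈-newBlue⁺ : ∀ {S u} → Forced G S u → u ∈ newBlue G S
  ∈-newBlue⁺ {S} {u} f = lookup⇒[]= u _ (trans (lookup-newBlue S u) (dec-true (forced? G S u) f))

  ∈-newBlue⁻ : ∀ {S u} → u ∈ newBlue G S → Forced G S u
  ∈-newBlue⁻ {S} {u} u∈ with forced? G S u | trans (sym (lookup-newBlue S u)) ([]=⇒lookup u∈)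
  ... | yes f | _ = f
  ... | no _  | ()

  ∈-∪-newBlue⁺ : ∀ P {x} → x ∈ P ⊎ Forced G P x → x ∈ P ∪ newBlue G P
  ∈-∪-newBlue⁺ P = x∈p∪q⁺ ∘ Sum.map₂ ∈-newBlue⁺

  ∈-∪-newBlue⁻ : ∀ P {x} → x ∈ P ∪ newBlue G P → x ∈ P ⊎ Forced G P x
  ∈-∪-newBlue⁻ P = Sum.map₂ ∈-newBlue⁻ ∘ x∈p∪q⁻ P _

  ∉-propagate-⊥ : ∀ k {x} → x ∉ propagate G ⊥ k
  ∉-propagate-⊥ zero = ∉⊥
  ∉-propagate-⊥ (suc k) x∈ with ∈-∪-newBlue⁻ (propagate G ⊥ k) x∈
  ... | inj₁ x∈′ = ∉-propagate-⊥ k x∈′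
  ... | inj₂ (_ , v∈ , _) = ∉-propagate-⊥ k v∈

  propagate-⊆⁅⁆ : ∀ {S a l r} → Adj G a l → Adj G a r → l ≢ r → S ⊆ ⁅ a ⁆ → ∀ k → propagate G S k ⊆ ⁅ a ⁆
  propagate-⊆⁅⁆ _ _ _ S⊆⁅a⁆ zero = S⊆⁅a⁆
  propagate-⊆⁅⁆ {S} {a} {l} {r} a~l a~r l≢r S⊆⁅a⁆ (suc k) x∈ =
    Sum.[ blue⊆⁅a⁆ , ⊥-elim ∘ nothing-forced ] (∈-∪-newBlue⁻ (propagate G S k) x∈)
    where
    blue⊆⁅a⁆ : propagate G S k ⊆ ⁅ a ⁆
    blue⊆⁅a⁆ = propagate-⊆⁅⁆ a~l a~r l≢r S⊆⁅a⁆ k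

    white : ∀ {w} → Adj G a w → w ∉ propagate G S k
    white a~w w∈ = irrefl G (subst (Adj G a) (x∈⁅y⁆⇒x≡y a (blue⊆⁅a⁆ w∈)) a~w)

    nothing-forced : ∀ {x} → ¬ Forced G (propagate G S k) x
    nothing-forced (v , v∈ , _ , _ , unique) with x∈⁅y⁆⇒x≡y a (blue⊆⁅a⁆ v∈)
    ... | refl = l≢r (trans (unique l a~l (white a~l)) (sym (unique r a~r (white a~r))))

module _ {n} (G : Graph (suc n)) where

  ¬IsZFS-⊥ : ¬ IsZFS G (⊥ {suc n})
  ¬IsZFS-⊥ (k , full) = ∉-propagate-⊥ G k (≡⊤⇒∈ full fzero)

  IsFTZFS⇒2≤∣B∣ : ∀ {B} → IsFTZFS G B → 2 ≤ ∣ B ∣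
  IsFTZFS⇒2≤∣B∣ {B} (_ , deletions-are-ZFS) with 2 ≤? ∣ B ∣
  ... | yes 2≤∣B∣ = 2≤∣B∣
  ... | no 2≰∣B∣ = ⊥-elim (¬IsZFS-⊥ (deletions-are-ZFS (⊥ {suc n}) (⊆-min B) ∣⊥∣≡∣B∣∸1))
    where
    ∣⊥∣≡∣B∣∸1 : ∣ ⊥ {suc n} ∣ ≡ ∣ B ∣ ∸ 1
    ∣⊥∣≡∣B∣∸1 = trans (∣⊥∣≡0 (suc n)) (sym (m≤n⇒m∸n≡0 (≤-pred (≰⇒> 2≰∣B∣))))

module InvolutiveAutomorphism {n} (G : Graph n) (σ : Fin n → Fin n)
  (σ-involutive : ∀ x → σ (σ x) ≡ x) (σ-adj : ∀ {u v} → Adj G u v → Adj G (σ u) (σ v)) where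

  _↦_ : Subset n → Subset n → Set
  T ↦ S = ∀ {x} → x ∈ T → σ x ∈ S

  _⇄_ : Subset n → Subset n → Set
  T ⇄ S = T ↦ S × S ↦ T

  ↦-inv : ∀ {T S x} → T ↦ S → σ x ∈ T → x ∈ S
  ↦-inv {S = S} {x} T↦S σx∈T = subst (_∈ S) (σ-involutive x) (T↦S σx∈T)

  forced-⇄ : ∀ {T S u} → T ⇄ S → Forced G T u → Forced G S (σ u)
  forced-⇄ {T} {S} {u} (T↦S , S↦T) (v , v∈T , u∉T , v~u , unique) =
    σ v , T↦S v∈T , u∉T ∘ ↦-inv S↦T , σ-adj v~u , unique′
    where
    unique′ : ∀ w → Adj G (σ v) w → w ∉ S → w ≡ σ u
    unique′ w σv~w w∉S = begin
      w         ≡⟨ σ-involutive w ⟨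
      σ (σ w)   ≡⟨ cong σ (unique (σ w) v~σw (w∉S ∘ ↦-inv T↦S)) ⟩
      σ u       ∎
      where
      open ≡-Reasoning
      v~σw : Adj G v (σ w)
      v~σw = subst (λ z → Adj G z (σ w)) (σ-involutive v) (σ-adj σv~w)

  ∪-newBlue-↦ : ∀ {T S} → T ⇄ S → (T ∪ newBlue G T) ↦ (S ∪ newBlue G S)
  ∪-newBlue-↦ {T} {S} T⇄S x∈ =
    ∈-∪-newBlue⁺ G S (Sum.map (proj₁ T⇄S) (forced-⇄ T⇄S) (∈-∪-newBlue⁻ G T x∈))

  propagate-⇄ : ∀ {T S} → T ⇄ S → ∀ k → propagate G T k ⇄ propagate G S k
  propagate-⇄ T⇄S zero = T⇄S
  propagate-⇄ T⇄S (suc k) = ∪-newBlue-↦ P⇄Q , ∪-newBlue-↦ (swap P⇄Q)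
    where P⇄Q = propagate-⇄ T⇄S k

  ⁅x⁆↦⁅σx⁆ : ∀ x → ⁅ x ⁆ ↦ ⁅ σ x ⁆
  ⁅x⁆↦⁅σx⁆ x y∈⁅x⁆ = subst (λ z → σ z ∈ ⁅ σ x ⁆) (sym (x∈⁅y⁆⇒x≡y x y∈⁅x⁆)) (x∈⁅x⁆ (σ x))

  ⁅x⁆⇄⁅σx⁆ : ∀ x → ⁅ x ⁆ ⇄ ⁅ σ x ⁆
  ⁅x⁆⇄⁅σx⁆ x = ⁅x⁆↦⁅σx⁆ x , subst (λ z → ⁅ σ x ⁆ ↦ ⁅ z ⁆) (σ-involutive x) (⁅x⁆↦⁅σx⁆ (σ x))

  propagate-≡⊤-⇄ : ∀ {T S k} → T ⇄ S → propagate G T k ≡ ⊤ → propagate G S k ≡ ⊤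
  propagate-≡⊤-⇄ {k = k} T⇄S full = ∀∈⇒≡⊤ (λ x → ↦-inv (proj₁ (propagate-⇄ T⇄S k)) (≡⊤⇒∈ full (σ x)))

dist : ∀ {n} → Fin n → Fin n → ℕ
dist x y = ∣ toℕ x - toℕ y ∣

∣n-1+n∣≡1 : ∀ n → ∣ n - suc n ∣ ≡ 1
∣n-1+n∣≡1 zero    = refl
∣n-1+n∣≡1 (suc n) = ∣n-1+n∣≡1 n

PathAdj⇒dist≡1 : ∀ {n} {x y : Fin n} → PathAdj x y → dist x y ≡ 1
PathAdj⇒dist≡1 {x = x} (inj₁ 1+x≡y) = subst (λ t → ∣ toℕ x - t ∣ ≡ 1) 1+x≡y (∣n-1+n∣≡1 (toℕ x))
PathAdj⇒dist≡1 {y = y} (inj₂ 1+y≡x) =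
  subst (λ t → ∣ t - toℕ y ∣ ≡ 1) 1+y≡x (trans (∣-∣-comm (suc (toℕ y)) (toℕ y)) (∣n-1+n∣≡1 (toℕ y)))

propagate-dist : ∀ {n} {S : Subset n} k {x} → x ∈ propagate (PathGraph n) S k → ∃ λ s → s ∈ S × dist x s ≤ k
propagate-dist zero {x} x∈S = x , x∈S , ≤-reflexive (∣n-n∣≡0 (toℕ x))
propagate-dist {n} {S} (suc k) {x} x∈ with ∈-∪-newBlue⁻ (PathGraph n) (propagate (PathGraph n) S k) x∈
... | inj₁ x∈′ with propagate-dist k x∈′
...   | s , s∈S , x-s≤k = s , s∈S , m≤n⇒m≤1+n x-s≤k
propagate-dist {n} {S} (suc k) {x} x∈ | inj₂ (v , v∈ , _ , v~x , _) with propagate-dist k v∈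
...   | s , s∈S , v-s≤k = s , s∈S , (begin
  dist x s             ≤⟨ ∣-∣-triangle (toℕ x) (toℕ v) (toℕ s) ⟩
  dist x v + dist v s  ≤⟨ +-mono-≤ (≤-reflexive (PathAdj⇒dist≡1 (Graph.sym (PathGraph n) v~x))) v-s≤k ⟩
  suc k                ∎)
  where open ≤-Reasoning

propagate-dist-⊆⁅⁆ : ∀ {n} {S : Subset n} {a} k {x} → S ⊆ ⁅ a ⁆ → x ∈ propagate (PathGraph n) S k → dist x a ≤ k
propagate-dist-⊆⁅⁆ {a = a} k {x} S⊆⁅a⁆ x∈ with propagate-dist k x∈
... | s , s∈S , x-s≤k = subst (λ z → dist x z ≤ k) (x∈⁅y⁆⇒x≡y a (S⊆⁅a⁆ s∈S)) x-s≤k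

opposite-PathAdj : ∀ {n} {u v : Fin n} → PathAdj u v → PathAdj (opposite u) (opposite v)
opposite-PathAdj = Sum.map reflect reflect ∘ Sum.swap
  where
  reflect : ∀ {n} {i j : Fin n} → suc (toℕ i) ≡ toℕ j → suc (toℕ (opposite j)) ≡ toℕ (opposite i)
  reflect {n} {i} {j} 1+i≡j = begin
    suc (toℕ (opposite j))   ≡⟨ cong suc (opposite-prop j) ⟩
    suc (n ∸ suc (toℕ j))    ≡⟨ +-∸-assoc 1 (toℕ<n j) ⟨
    n ∸ toℕ j                ≡⟨ cong (n ∸_) 1+i≡j ⟨
    n ∸ suc (toℕ i)          ≡⟨ opposite-prop i ⟨
    toℕ (opposite i)         ∎
    where open ≡-Reasoning

interior-neighbours : ∀ {m} (s : Fin (suc m)) → toℕ s ≢ 0 → toℕ s ≢ m →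
                      ∃₂ λ l r → PathAdj s l × PathAdj s r × l ≢ r
interior-neighbours fzero    s≢0 _ = ⊥-elim (s≢0 refl)
interior-neighbours {m} s@(fsuc t) _ s≢m =
  inject₁ t , fromℕ< 1+s<1+m , inj₂ (cong suc (toℕ-inject₁ t)) , inj₁ (sym (toℕ-fromℕ< 1+s<1+m)) , l≢r
  where
  1+s<1+m : suc (toℕ s) < suc m
  1+s<1+m = s≤s (≤∧≢⇒< (≤-pred (toℕ<n s)) s≢m)
  l≢r : inject₁ t ≢ fromℕ< 1+s<1+m
  l≢r l≡r = <⇒≢ (m<n⇒m<1+n (n<1+n (toℕ t)))
                (trans (sym (toℕ-inject₁ t)) (trans (cong toℕ l≡r) (toℕ-fromℕ< 1+s<1+m)))

module _ {m : ℕ} where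

  private
    P : Graph (suc m)
    P = PathGraph (suc m)

  pt-lower : ∀ {S j} → ∣ S ∣ ≤ 1 → propagate P S j ≡ ⊤ → m ≤ j
  pt-lower {S} {j} ∣S∣≤1 full with propagate-dist j (≡⊤⇒∈ full fzero)
  ... | a , a∈S , a≤j = by-position (toℕ a ≟ℕ 0) (toℕ a ≟ℕ m)
    where
    S⊆⁅a⁆ : S ⊆ ⁅ a ⁆
    S⊆⁅a⁆ = ∣p∣≤1⇒⊆⁅x⁆ ∣S∣≤1 a∈S

    last-a≤j : dist (fromℕ m) a ≤ j
    last-a≤j = propagate-dist-⊆⁅⁆ j S⊆⁅a⁆ (≡⊤⇒∈ full (fromℕ m))

    by-position : Dec (toℕ a ≡ 0) → Dec (toℕ a ≡ m) → m ≤ j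
    by-position _         (yes a≡m) = subst (_≤ j) a≡m a≤j
    by-position (yes a≡0) (no _)    =
      subst (_≤ j) (trans (cong₂ ∣_-_∣ (toℕ-fromℕ m) a≡0) (∣-∣-identityʳ m)) last-a≤j
    by-position (no a≢0)  (no a≢m) with interior-neighbours a a≢0 a≢m
    ... | l , r , a~l , a~r , l≢r =
      ⊥-elim (a≢0 (cong toℕ (sym (x∈⁅y⁆⇒x≡y a (propagate-⊆⁅⁆ P a~l a~r l≢r S⊆⁅a⁆ j (≡⊤⇒∈ full fzero))))))

  ≡⊤⇒IsPT : ∀ {S} → ∣ S ∣ ≤ 1 → propagate P S m ≡ ⊤ → IsPT P S m
  ≡⊤⇒IsPT ∣S∣≤1 full = full , λ j j<m full′ → <⇒≱ j<m (pt-lower ∣S∣≤1 full′)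

  Blue-up-to : ℕ → Set
  Blue-up-to k = ∀ {y} → toℕ y ≤ k → y ∈ propagate P ⁅ fzero ⁆ k

  -- At time k = toℕ t the vertex inject₁ t = k forces fsuc t = k + 1: its other neighbour k − 1 is blue.
  sweep-step : ∀ {k} → Blue-up-to k → Blue-up-to (suc k)
  sweep-step {k} blue {y} y≤1+k with m≤n⇒m<n∨m≡n y≤1+k
  ... | inj₁ y<1+k = ∈-∪-newBlue⁺ P _ (inj₁ (blue (≤-pred y<1+k)))
  sweep-step {.(toℕ t)} blue {fsuc t} _ | inj₂ refl =
    ∈-∪-newBlue⁺ P _ (inj₂ (inject₁ t , blue (≤-reflexive (toℕ-inject₁ t)) , y-white , v~y , unique))
    where
    y-white : fsuc t ∉ propagate P ⁅ fzero ⁆ (toℕ t)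
    y-white y∈ = n≮n (toℕ t) (propagate-dist-⊆⁅⁆ {a = fzero} (toℕ t) (λ x∈ → x∈) y∈)
    v~y : PathAdj (inject₁ t) (fsuc t)
    v~y = inj₁ (cong suc (toℕ-inject₁ t))
    unique : ∀ w → PathAdj (inject₁ t) w → w ∉ propagate P ⁅ fzero ⁆ (toℕ t) → w ≡ fsuc t
    unique w (inj₁ 1+v≡w) _       = toℕ-injective (trans (sym 1+v≡w) (cong suc (toℕ-inject₁ t)))
    unique w (inj₂ 1+w≡v) w-white =
      ⊥-elim (w-white (blue (≤-trans (n≤1+n (toℕ w)) (≤-reflexive (trans 1+w≡v (toℕ-inject₁ t))))))

  sweep-⁅0⁆ : ∀ k → Blue-up-to k
  sweep-⁅0⁆ zero    {fzero} _ = x∈⁅x⁆ fzero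
  sweep-⁅0⁆ (suc k)           = sweep-step (sweep-⁅0⁆ k)

  pt-⁅0⁆ : IsPT P ⁅ fzero ⁆ m
  pt-⁅0⁆ = ≡⊤⇒IsPT (≤-reflexive (∣⁅x⁆∣≡1 {suc m} fzero)) (∀∈⇒≡⊤ (λ y → sweep-⁅0⁆ m (≤-pred (toℕ<n y))))

  pt-⁅last⁆ : IsPT P ⁅ fromℕ m ⁆ m
  pt-⁅last⁆ =
    ≡⊤⇒IsPT (≤-reflexive (∣⁅x⁆∣≡1 (fromℕ m))) (propagate-≡⊤-⇄ {k = m} (⁅x⁆⇄⁅σx⁆ fzero) (proj₁ pt-⁅0⁆))
    where open InvolutiveAutomorphism P opposite opposite-involutive opposite-PathAdj

module Endpoints (m : ℕ) where

  private
    P : Graph (suc (suc m))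
    P = PathGraph (suc (suc m))

  -- The set {0, m + 1}, written so that its size computes.
  endpoints : Subset (suc (suc m))
  endpoints = inside ∷ ⁅ fromℕ m ⁆

  ∣endpoints∣≡2 : ∣ endpoints ∣ ≡ 2
  ∣endpoints∣≡2 = cong suc (∣⁅x⁆∣≡1 (fromℕ m))

  pt-endpoint : ∀ {a} → a ∈ endpoints → IsPT P ⁅ a ⁆ (suc m)
  pt-endpoint here = pt-⁅0⁆
  pt-endpoint (there a∈⁅last⁆) rewrite x∈⁅y⁆⇒x≡y (fromℕ m) a∈⁅last⁆ = pt-⁅last⁆

  pt-⊆endpoints : ∀ {S a} → S ⊆ endpoints → ∣ S ∣ ≤ 1 → a ∈ S → IsPT P S (suc m)
  pt-⊆endpoints {S} S⊆ ∣S∣≤1 a∈S =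
    subst (λ T → IsPT P T (suc m)) (sym (∣p∣≤1⇒≡⁅x⁆ ∣S∣≤1 a∈S)) (pt-endpoint (S⊆ a∈S))

  endpoints-FTZFS : IsFTZFS P endpoints
  endpoints-FTZFS = s≤s z≤n , λ S S⊆ ∣S∣≡1 →
    let ∣S∣≡1′ = trans ∣S∣≡1 (∣⁅x⁆∣≡1 (fromℕ m))
        a , a∈S = 1≤∣p∣⇒Nonempty S (≤-reflexive (sym ∣S∣≡1′))
    in suc m , proj₁ (pt-⊆endpoints S⊆ (≤-reflexive ∣S∣≡1′) a∈S)

  endpoints-min : IsMinFTZFS P endpoints
  endpoints-min =
    endpoints-FTZFS , λ C C-FTZFS → subst (_≤ ∣ C ∣) (sym ∣endpoints∣≡2) (IsFTZFS⇒2≤∣B∣ P C-FTZFS)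

  other-endpoint : ∀ {b} → b ∈ endpoints → Nonempty (endpoints ─ ⁅ b ⁆)
  other-endpoint here          =
    fsuc (fromℕ m) , x∈p∧x≢y⇒x∈p-y {p = endpoints} {y = fzero} (there (x∈⁅x⁆ (fromℕ m))) λ ()
  other-endpoint {b} (there _) = fzero , x∈p∧x≢y⇒x∈p-y {p = endpoints} {y = b} here λ ()

  endpoints-fpt : IsFPTOf P endpoints (suc m)
  endpoints-fpt = (λ b b∈ → suc m , pt-deleting b∈ , ≤-refl) , fzero , here , pt-deleting here
    where
    pt-deleting : ∀ {b} → b ∈ endpoints → IsPT P (endpoints ─ ⁅ b ⁆) (suc m)
    pt-deleting {b} b∈ = let a , a∈ = other-endpoint b∈ in
      pt-⊆endpoints (p─q⊆p endpoints ⁅ b ⁆)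
                    (≤-pred (subst (∣ endpoints ─ ⁅ b ⁆ ∣ <_) ∣endpoints∣≡2 (x∈p⇒∣p-x∣<∣p∣ b∈))) a∈

  fpt-lower : ∀ {B j} → IsMinFTZFS P B → IsFPTOf P B j → suc m ≤ j
  fpt-lower {B} (_ , B-min) (_ , b , b∈B , full , _) = pt-lower ∣B-b∣≤1 full
    where
    ∣B∣≤2 : ∣ B ∣ ≤ 2
    ∣B∣≤2 = subst (∣ B ∣ ≤_) ∣endpoints∣≡2 (B-min endpoints endpoints-FTZFS)
    ∣B-b∣≤1 : ∣ B ─ ⁅ b ⁆ ∣ ≤ 1
    ∣B-b∣≤1 = ≤-pred (≤-trans (x∈p⇒∣p-x∣<∣p∣ b∈B) ∣B∣≤2)

proposition5p6 : ∀ (n : ℕ) → 2 ≤ n → IsFPT (PathGraph n) (n ∸ 1)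
proposition5p6 (suc zero) (s≤s ())
proposition5p6 (suc (suc m)) _ = (endpoints , endpoints-min , endpoints-fpt) , λ _ _ → fpt-lower
  where open Endpoints m
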